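{- Let $P=P(G,[\omega])$ be a toric poset over a finite simple graph $G=(V,E)$ and $I\subseteq V$. Then $I$ is a toric filter of $P$ (i.e. $\chi_I$ is the characteristic function of a toric filter of $P$) if and only if $\chi_I$ is a vertex of the order polytope $\mathcal{O}(P(G,\omega'))$ for some $\omega'\in[\omega]$.
   Context: $\chi_I\in\{0,1\}^V\subseteq\mathbb{R}^V$ is the vector with $(\chi_I)_k=1$ if $k\in I$ and $0$ otherwise. $P(G,\omega')$ is the poset on $V$ with $a\le b$ iff there is a directed path from $a$ to $b$ in $\omega'$, and $\mathcal{O}(P(G,\omega'))=\{x\in[0,1]^V: x_a\le x_b$ whenever $a\le b$ in $P(G,\omega')\}$. Toric equivalence of acyclic orientations is generated by converting a source into a sink; $[\omega]$ is the class of $\omega$. Representing coordinates in $[0,1)$, the toric chamber $c(P)\subseteq\mathbb{R}^V/\mathbb{Z}^V$ is the set of $x$ with $x_a\ne x_b$ for $\{a,b\}\in E$ whose orientation (edge $a\to b$ iff $x_a<x_b$) lies in $[\omega]$. With $q:\mathbb{R}^V\to\mathbb{R}^V/\mathbb{Z}^V$ and partition $\pi$, $D_\pi=\{x\in\mathbb{R}^V:x_a=x_b$ whenever $a,b$ share a block$\}$, $D^{\mathrm{tor}}_\pi=q(D_\pi)$. Toric filter: $\varnothing$ and $V$ are toric filters; for $\varnothing\ne I\subsetneq V$ with $\pi=\{I,V\setminus I\}$, $I$ is a toric filter iff $\overline{c(P)}\cap D^{\mathrm{tor}}_\pi$ is $2$-dimensional (equivalently, $\pi$ is closed with respect to $P$,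 giving a morphism of $P$ onto a toric poset on two elements).
   Formalization: Points of the torus ℝ^V/ℤ^V, of the toric chamber and its closure, and of the order polytope have rational coordinates, in ℚ^V rather than ℝ^V. -}

module Defs where

open import Data.Nat using (ℕ)
open import Data.Integer using (ℤ)
open import Data.Bool using (Bool; true; false; _∨_; _∧_; if_then_else_)
open import Data.Fin using (Fin; _≟_)
open import Data.Fin.Subset using (Subset; _∈_; _∉_)
open import Data.Fin.Subset.Properties using (_∈?_)
open import Data.Product using (Σ; ∃; ∃-syntax; _×_)
open import Data.Sum using (_⊎_)
open import Relation.Nullary using (¬_; does)
open import Relation.Binary.PropositionalEquality using (_≡_; _≢_)
open import Relation.Binary.Construct.Closure.Transitive using (TransClosure)
open import Relation.Binary.Construct.Closure.ReflexiveTransitive using (Star)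
open import Data.Rational using (ℚ; 0ℚ; 1ℚ; _+_; _*_; _-_; _/_; ∣_∣; _≤_; _<_)
open import Data.Rational.Properties using (_<?_)

-- Graphs and orientations on the vertex set V = Fin n.
-- A graph is a Bool-valued adjacency function; an orientation is a
-- Bool-valued function with  ω a b ≡ true  meaning the edge a → b.

Graph : ℕ → Set
Graph n = Fin n → Fin n → Bool

Orientation : ℕ → Set
Orientation n = Fin n → Fin n → Bool

IsSimple : ∀ {n} → Graph n → Set
IsSimple {n} G = (∀ (a b : Fin n) → G a b ≡ G b a) × (∀ (a : Fin n) → G a a ≡ false)

IsOrientationOf : ∀ {n} → Graph n → Orientation n → Set
IsOrientationOf {n} G ω =
  (∀ (a b : Fin n) → ω a b ≡ true → G a b ≡ true) ×
  (∀ (a b : Fin n) → G a b ≡ true → ω a b ≢ ω b a)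

DPath : ∀ {n} → Orientation n → Fin n → Fin n → Set
DPath ω = TransClosure (λ a b → ω a b ≡ true)

IsAcyclic : ∀ {n} → Orientation n → Set
IsAcyclic {n} ω = ∀ (a : Fin n) → ¬ DPath ω a a

IsAcyclicOrientation : ∀ {n} → Graph n → Orientation n → Set
IsAcyclicOrientation G ω = IsOrientationOf G ω × IsAcyclic ω

IsSource : ∀ {n} → Graph n → Orientation n → Fin n → Set
IsSource {n} G ω v = ∀ (u : Fin n) → G v u ≡ true → ω v u ≡ true

flipAt : ∀ {n} → Orientation n → Fin n → Orientation n
flipAt ω v a b = if does (a ≟ v) ∨ does (b ≟ v) then ω b a else ω a b

PointwiseEq : ∀ {n} → Orientation n → Orientation n → Set
PointwiseEq {n} ω ω' = ∀ (a b : Fin n) → ω a b ≡ ω' a b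

SourceToSink : ∀ {n} → Graph n → Orientation n → Orientation n → Set
SourceToSink {n} G ω ω' = Σ (Fin n) λ v → IsSource G ω v × PointwiseEq (flipAt ω v) ω'

ToricStep : ∀ {n} → Graph n → Orientation n → Orientation n → Set
ToricStep G ω ω' = PointwiseEq ω ω' ⊎ SourceToSink G ω ω' ⊎ SourceToSink G ω' ω

ToricEquiv : ∀ {n} → Graph n → Orientation n → Orientation n → Set
ToricEquiv G = Star (ToricStep G)

PLe : ∀ {n} → Orientation n → Fin n → Fin n → Set
PLe ω = Star (λ a b → ω a b ≡ true)

Point : ℕ → Set
Point n = Fin n → ℚ

InOrderPolytope : ∀ {n} → Orientation n → Point n → Set
InOrderPolytope {n} ω x =
  (∀ (a : Fin n) → 0ℚ ≤ x a × x a ≤ 1ℚ) ×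
  (∀ (a b : Fin n) → PLe ω a b → x a ≤ x b)

IsVertexOfOrderPolytope : ∀ {n} → Orientation n → Point n → Set
IsVertexOfOrderPolytope {n} ω x =
  InOrderPolytope ω x ×
  (∀ (y z : Point n) (t : ℚ) → InOrderPolytope ω y → InOrderPolytope ω z →
     0ℚ < t → t < 1ℚ →
     (∀ (a : Fin n) → x a ≡ t * y a + (1ℚ - t) * z a) →
     ∀ (a : Fin n) → y a ≡ z a)

χ : ∀ {n} → Subset n → Point n
χ I a = if does (a ∈? I) then 1ℚ else 0ℚ

-- The toric chamber c(P) ⊆ ℝ^V/ℤ^V, its closure, and toric filters.
-- Points of the torus are represented by points of ℚ^V.

ℤtoℚ : ℤ → ℚ
ℤtoℚ k = k / 1

orientOf : ∀ {n} → Graph n → Point n → Orientation n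
orientOf G x a b = G a b ∧ does (x a <? x b)

-- q(z) ∈ c(P(G,[ω])): the representative x of z in [0,1)^V is nonequal
-- along edges and induces an orientation in [ω]
InChamber : ∀ {n} → Graph n → Orientation n → Point n → Set
InChamber {n} G ω z =
  Σ (Point n) λ x →
    (∀ (a : Fin n) → 0ℚ ≤ x a × x a < 1ℚ) ×
    (∀ (a : Fin n) → ∃[ k ] x a ≡ z a + ℤtoℚ k) ×
    (∀ (a b : Fin n) → G a b ≡ true → x a ≢ x b) ×
    ToricEquiv G ω (orientOf G x)

InClosure : ∀ {n} → Graph n → Orientation n → Point n → Set
InClosure {n} G ω y =
  ∀ (δ : ℚ) → 0ℚ < δ →
    Σ (Point n) λ z → InChamber G ω z ×
      (∀ (a : Fin n) → ∃[ k ] ∣ y a - z a - ℤtoℚ k ∣ < δ)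

-- the point of D_π with value s on I and t on V ∖ I  (π = {I, V ∖ I})
twoBlock : ∀ {n} → Subset n → ℚ → ℚ → Point n
twoBlock I s t a = if does (a ∈? I) then s else t

-- closure(c(P)) ∩ D^tor_π is 2-dimensional: it contains a nonempty open
-- subset of the 2-torus D^tor_π
ClosureMeetsDIsTwoDim : ∀ {n} → Graph n → Orientation n → Subset n → Set
ClosureMeetsDIsTwoDim G ω I =
  Σ ℚ λ s₀ → Σ ℚ λ t₀ → Σ ℚ λ ε → 0ℚ < ε ×
    (∀ (s t : ℚ) → ∣ s - s₀ ∣ < ε → ∣ t - t₀ ∣ < ε →
       InClosure G ω (twoBlock I s t))

IsToricFilter : ∀ {n} → Graph n → Orientation n → Subset n → Set
IsToricFilter {n} G ω I =
  (∀ (a : Fin n) → a ∉ I) ⊎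
  (∀ (a : Fin n) → a ∈ I) ⊎
  ((∃[ a ] a ∈ I) × (∃[ b ] b ∉ I) × ClosureMeetsDIsTwoDim G ω I)

{-# OPTIONS --safe #-}

-- Both sides say that I is an up-set of some ω′ ∈ [ω]: χ_I is a vertex of
-- O(P(G,ω′)) exactly when I is an up-set of ω′, since a 0/1 point of the cube
-- is extreme.  Points of the toric chamber are handled through lifts x ∈ ℚ^V
-- on which every edge has length strictly between 0 and 1: adding 1 at a
-- source is then a source-to-sink flip, so every ω′ ∈ [ω] has such a lift, and
-- two lifts of the same torus point have toric-equivalent orientations.
-- If I is an up-set of ω′, a point of D_π with values near ¾ on I and near ¼
-- off I, plus a small multiple of a lift of ω′, lies in the chamber; this gives
-- an open square of D^tor_π in the closure.  Conversely, an open square in the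
-- closure contains, after an integer shift, a point of D_π whose levels s > t
-- satisfy h ≤ s - t ≤ 1 - h; lifts of nearby chamber points keep I above its
-- complement inside a window of length < 1, so their orientation lies in [ω]
-- and has I as an up-set.

module Submission where

open import Defs
open import Function using (_∘_)
open import Function.Bundles using (_⇔_; mk⇔; module Equivalence)
open Equivalence using (to; from)
open import Data.Unit using (⊤; tt)
open import Data.Empty using (⊥-elim)
open import Data.Bool using (true; false; _∨_; if_then_else_)
open import Data.Bool.Properties using (∧-zeroʳ)
open import Data.Product using (Σ; ∃-syntax; _×_; _,_; proj₁; proj₂)
open import Data.Sum as Sum using (_⊎_; inj₁; inj₂)
open import Data.Nat as ℕ using (ℕ; zero; suc)
import Data.Nat.Properties as ℕP
import Data.Nat.Coprimality as Coprimality
open import Data.Integer as ℤ using (ℤ; +_; -[1+_])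
import Data.Integer.Properties as ℤP
import Data.Integer.DivMod as ℤ
open import Data.Rational
  using (ℚ; mkℚ; 0ℚ; 1ℚ; ½; _+_; _*_; _-_; -_; _/_; ∣_∣; _≤_; _<_; *≤*; *<*; floor; _⊔_; _⊓_; 1/_;
         Positive; NonZero; positive; nonNegative)
open import Data.Rational.Properties hiding (_≟_)
open import Data.Fin as Fin using (Fin; _≟_)
import Data.Fin.Properties as FinP
open import Data.Fin.Subset using (Subset; _∈_; _∉_)
open import Data.Fin.Subset.Properties using (_∈?_)
open import Algebra.Properties.CommutativeMonoid.Sum ℕP.+-0-commutativeMonoid using (sum; sum-cong-≗)
open import Relation.Unary using (Decidable)
open import Relation.Nullary using (¬_; Dec; yes; no; does; ¬?)
open import Relation.Nullary.Decidable using (dec-true; dec-false; from-yes; decidable-stable)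
open import Relation.Binary.PropositionalEquality
open import Relation.Binary.Definitions using (tri<; tri≈; tri>)
open import Relation.Binary.Construct.Closure.ReflexiveTransitive using (ε; _◅_; _◅◅_)
open import Relation.Binary.Construct.Closure.Transitive using ([_]) renaming (_∷_ to _∷⁺_)
open import Data.Rational.Solver using (module +-*-Solver)
open +-*-Solver using (solve; _:=_; con; _:+_; _:*_; _:-_; :-_)

integral : ℤ → ℚ
integral i = mkℚ i 0 (Coprimality.sym (Coprimality.1-coprimeTo _))

ℤtoℚ≡integral : ∀ i → ℤtoℚ i ≡ integral i
ℤtoℚ≡integral i = ↥p/↧p≡p _

ℤtoℚ-+ : ∀ i j → ℤtoℚ (i ℤ.+ j) ≡ ℤtoℚ i + ℤtoℚ j
ℤtoℚ-+ i j rewrite ℤtoℚ≡integral i | ℤtoℚ≡integral j =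
  sym (/-cong (cong₂ ℤ._+_ (ℤP.*-identityʳ i) (ℤP.*-identityʳ j)) refl)

ℤtoℚ-neg : ∀ i → ℤtoℚ (ℤ.- i) ≡ - ℤtoℚ i
ℤtoℚ-neg i = trans (ℤtoℚ≡integral (ℤ.- i)) (trans (integral-neg i) (cong -_ (sym (ℤtoℚ≡integral i))))
  where
  integral-neg : ∀ i → integral (ℤ.- i) ≡ - integral i
  integral-neg (+ zero)  = refl
  integral-neg (+ suc n) = refl
  integral-neg -[1+ n ]  = refl

ℤtoℚ-- : ∀ i j → ℤtoℚ (i ℤ.- j) ≡ ℤtoℚ i - ℤtoℚ j
ℤtoℚ-- i j = trans (ℤtoℚ-+ i (ℤ.- j)) (cong (_+_ (ℤtoℚ i)) (ℤtoℚ-neg j))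

ℤtoℚ-mono-< : ∀ {i j} → i ℤ.< j → ℤtoℚ i < ℤtoℚ j
ℤtoℚ-mono-< {i} {j} i<j rewrite ℤtoℚ≡integral i | ℤtoℚ≡integral j =
  *<* (subst₂ ℤ._<_ (sym (ℤP.*-identityʳ i)) (sym (ℤP.*-identityʳ j)) i<j)

ℤtoℚ-mono-≤ : ∀ {i j} → i ℤ.≤ j → ℤtoℚ i ≤ ℤtoℚ j
ℤtoℚ-mono-≤ {i} {j} i≤j rewrite ℤtoℚ≡integral i | ℤtoℚ≡integral j =
  *≤* (subst₂ ℤ._≤_ (sym (ℤP.*-identityʳ i)) (sym (ℤP.*-identityʳ j)) i≤j)

ℤtoℚ-cancel-≤ : ∀ {i j} → ℤtoℚ i ≤ ℤtoℚ j → i ℤ.≤ j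
ℤtoℚ-cancel-≤ {i} {j} p rewrite ℤtoℚ≡integral i | ℤtoℚ≡integral j with p
... | *≤* i≤j = subst₂ ℤ._≤_ (ℤP.*-identityʳ i) (ℤP.*-identityʳ j) i≤j

floor-bounds : ∀ q → ℤtoℚ (floor q) ≤ q × q < ℤtoℚ (floor q) + 1ℚ
floor-bounds q@(mkℚ i d-1 _) = lower , upper
  where
  d : ℕ
  d = suc d-1
  lower : ℤtoℚ (floor q) ≤ q
  lower rewrite ℤtoℚ≡integral (floor q) =
    *≤* (subst (floor q ℤ.* + d ℤ.≤_) (sym (ℤP.*-identityʳ i)) (ℤ.[n/d]*d≤n i (+ d)))
  upper′ : q < ℤtoℚ (ℤ.suc (i ℤ./ℕ d))
  upper′ rewrite ℤtoℚ≡integral (ℤ.suc (i ℤ./ℕ d)) =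
    *<* (subst (ℤ._< ℤ.suc (i ℤ./ℕ d) ℤ.* + d) (sym (ℤP.*-identityʳ i)) (ℤ.n<s[n/ℕd]*d i d))
  upper : q < ℤtoℚ (floor q) + 1ℚ
  upper = subst (q <_) (begin
    ℤtoℚ (ℤ.suc (i ℤ./ℕ d))  ≡⟨ cong (ℤtoℚ ∘ ℤ.suc) (ℤ.div-pos-is-/ℕ i d) ⟨
    ℤtoℚ (ℤ.suc (floor q))   ≡⟨ ℤtoℚ-+ (+ 1) (floor q) ⟩
    1ℚ + ℤtoℚ (floor q)      ≡⟨ +-comm 1ℚ (ℤtoℚ (floor q)) ⟩
    ℤtoℚ (floor q) + 1ℚ      ∎) upper′
    where open ≡-Reasoning

p<p+1 : ∀ p → p < p + 1ℚ
p<p+1 p = subst (_< p + 1ℚ) (+-identityʳ p) (+-monoʳ-< p (*<* (ℤ.+<+ (ℕ.s≤s ℕ.z≤n))))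

p≤∣p∣ : ∀ p → p ≤ ∣ p ∣
p≤∣p∣ (mkℚ (+ n) _ _)    = ≤-refl
p≤∣p∣ (mkℚ -[1+ n ] _ _) = *≤* ℤ.-≤+

∣p∣<r⇒-r<p<r : ∀ {p r} → ∣ p ∣ < r → - r < p × p < r
∣p∣<r⇒-r<p<r {p} {r} ∣p∣<r = subst (- r <_) (neg-involutive p) -r<--p , ≤-<-trans (p≤∣p∣ p) ∣p∣<r
  where
  -r<--p : - r < - (- p)
  -r<--p = neg-antimono-< (≤-<-trans (p≤∣p∣ (- p)) (subst (_< r) (sym (∣-p∣≡∣p∣ p)) ∣p∣<r))
  neg-involutive : ∀ p → - (- p) ≡ p
  neg-involutive = solve 1 (λ p → :- (:- p) := p) refl

p<q+1⇒p-1<q : ∀ {p q} → p < q + 1ℚ → p - 1ℚ < q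
p<q+1⇒p-1<q {p} {q} p<q+1 = subst (p - 1ℚ <_) (q+1-1≡q q) (+-monoˡ-< (- 1ℚ) p<q+1)
  where
  q+1-1≡q : ∀ q → q + 1ℚ - 1ℚ ≡ q
  q+1-1≡q = solve 1 (λ q → q :+ con 1ℚ :- con 1ℚ := q) refl

p≤q⇒0≤q-p : ∀ {p q} → p ≤ q → 0ℚ ≤ q - p
p≤q⇒0≤q-p {p} {q} p≤q = subst (_≤ q - p) (+-inverseʳ p) (+-monoˡ-≤ (- p) p≤q)

q<p+1⇒q-p<1 : ∀ {p q} → q < p + 1ℚ → q - p < 1ℚ
q<p+1⇒q-p<1 {p} {q} q<p+1 = subst (q - p <_) (p+1-p≡1 p) (+-monoˡ-< (- p) q<p+1)
  where
  p+1-p≡1 : ∀ p → p + 1ℚ - p ≡ 1ℚ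
  p+1-p≡1 = solve 1 (λ p → p :+ con 1ℚ :- p := con 1ℚ) refl

0<p⇒0<p*½ : ∀ {p} → 0ℚ < p → 0ℚ < p * ½
0<p⇒0<p*½ {p} 0<p = subst (_< p * ½) (*-zeroˡ ½) (*-monoˡ-<-pos ½ 0<p)

+-cancelʳ-< : ∀ r {p q} → p + r < q + r → p < q
+-cancelʳ-< r {p} {q} p+r<q+r = subst₂ _<_ (p+r-r≡p p r) (p+r-r≡p q r) (+-monoˡ-< (- r) p+r<q+r)
  where
  p+r-r≡p : ∀ p r → p + r - r ≡ p
  p+r-r≡p = solve 2 (λ p r → p :+ r :- r := p) refl

0<⊓ : ∀ {p q} → 0ℚ < p → 0ℚ < q → 0ℚ < p ⊓ q
0<⊓ {p} {q} 0<p 0<q with ⊓-sel p q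
... | inj₁ p⊓q≡p = subst (0ℚ <_) (sym p⊓q≡p) 0<p
... | inj₂ p⊓q≡q = subst (0ℚ <_) (sym p⊓q≡q) 0<q

∣p-q∣<δ⇒p-δ<q<p+δ : ∀ {p q δ} → ∣ p - q ∣ < δ → p - δ < q × q < p + δ
∣p-q∣<δ⇒p-δ<q<p+δ {p} {q} {δ} ∣p-q∣<δ =
  subst₂ _<_ (p-q+[q-δ]≡p-δ p q δ) (δ+[q-δ]≡q q δ) (+-monoˡ-< (q - δ) (proj₂ p-q-bounds)) ,
  subst₂ _<_ (-δ+[q+δ]≡q q δ) (p-q+[q+δ]≡p+δ p q δ) (+-monoˡ-< (q + δ) (proj₁ p-q-bounds))
  where
  p-q+[q-δ]≡p-δ : ∀ p q δ → p - q + (q - δ) ≡ p - δ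
  p-q+[q-δ]≡p-δ = solve 3 (λ p q δ → p :- q :+ (q :- δ) := p :- δ) refl
  δ+[q-δ]≡q : ∀ q δ → δ + (q - δ) ≡ q
  δ+[q-δ]≡q = solve 2 (λ q δ → δ :+ (q :- δ) := q) refl
  -δ+[q+δ]≡q : ∀ q δ → - δ + (q + δ) ≡ q
  -δ+[q+δ]≡q = solve 2 (λ q δ → :- δ :+ (q :+ δ) := q) refl
  p-q+[q+δ]≡p+δ : ∀ p q δ → p - q + (q + δ) ≡ p + δ
  p-q+[q+δ]≡p+δ = solve 3 (λ p q δ → p :- q :+ (q :+ δ) := p :+ δ) refl
  p-q-bounds : - δ < p - q × p - q < δ
  p-q-bounds = ∣p∣<r⇒-r<p<r ∣p-q∣<δ

argmin : ∀ {n} {P : Fin n → Set} → Decidable P → (f : Fin n → ℚ) →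
         (∀ a → ¬ P a) ⊎ ∃[ a ] P a × (∀ b → P b → f a ≤ f b)
argmin {zero} P? f = inj₁ (λ ())
argmin {suc n} P? f with argmin (P? ∘ Fin.suc) (f ∘ Fin.suc) | P? Fin.zero
... | inj₁ none | yes p₀ = inj₂ (Fin.zero , p₀ , λ { Fin.zero _ → ≤-refl ; (Fin.suc b) pb → ⊥-elim (none b pb) })
... | inj₁ none | no ¬p₀ = inj₁ (λ { Fin.zero → ¬p₀ ; (Fin.suc b) → none b })
... | inj₂ (a , pa , min) | no ¬p₀ =
  inj₂ (Fin.suc a , pa , λ { Fin.zero p₀ → ⊥-elim (¬p₀ p₀) ; (Fin.suc b) pb → min b pb })
... | inj₂ (a , pa , min) | yes p₀ with f Fin.zero ≤? f (Fin.suc a)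
...   | yes f₀≤fa = inj₂ (Fin.zero , p₀ , λ { Fin.zero _ → ≤-refl ; (Fin.suc b) pb → ≤-trans f₀≤fa (min b pb) })
...   | no f₀≰fa  = inj₂ (Fin.suc a , pa , λ { Fin.zero _ → <⇒≤ (≰⇒> f₀≰fa) ; (Fin.suc b) pb → min b pb })

upper-bound : ∀ {n} (f : Fin n → ℚ) → ∃[ M ] 0ℚ ≤ M × (∀ a → f a ≤ M)
upper-bound {zero} f = 0ℚ , ≤-refl , λ ()
upper-bound {suc n} f with upper-bound (f ∘ Fin.suc)
... | M , 0≤M , f≤M = f Fin.zero ⊔ M , ≤-trans 0≤M (p≤q⊔p (f Fin.zero) M) , bound
  where
  bound : ∀ a → f a ≤ f Fin.zero ⊔ M
  bound Fin.zero    = p≤p⊔q (f Fin.zero) M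
  bound (Fin.suc a) = ≤-trans (f≤M a) (p≤q⊔p (f Fin.zero) M)

small-multiple : ∀ {n} (x : Fin n → ℚ) {η} → 0ℚ < η → ∃[ γ ] 0ℚ < γ × (∀ a → ∣ γ * x a ∣ < η)
small-multiple x {η} 0<η with upper-bound (∣_∣ ∘ x)
... | M , 0≤M , ∣x∣≤M = γ , 0<γ , small
  where
  0<M+1 : 0ℚ < M + 1ℚ
  0<M+1 = ≤-<-trans 0≤M (p<p+1 M)
  instance
    M+1-pos : Positive (M + 1ℚ)
    M+1-pos = positive 0<M+1
    M+1-nonZero : NonZero (M + 1ℚ)
    M+1-nonZero = pos⇒nonZero (M + 1ℚ)
  γ : ℚ
  γ = η * 1/ (M + 1ℚ)
  0<γ : 0ℚ < γ
  0<γ = subst (_< γ) (*-zeroˡ (1/ (M + 1ℚ))) (*-monoˡ-<-pos (1/ (M + 1ℚ)) {{1/pos⇒pos (M + 1ℚ)}} 0<η)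
  small : ∀ a → ∣ γ * x a ∣ < η
  small a = begin-strict
    ∣ γ * x a ∣     ≡⟨ trans (∣p*q∣≡∣p∣*∣q∣ γ (x a)) (cong (_* ∣ x a ∣) (0≤p⇒∣p∣≡p (<⇒≤ 0<γ))) ⟩
    γ * ∣ x a ∣     ≤⟨ *-monoˡ-≤-nonNeg γ {{nonNegative (<⇒≤ 0<γ)}} (∣x∣≤M a) ⟩
    γ * M           <⟨ *-monoʳ-<-pos γ {{positive 0<γ}} (p<p+1 M) ⟩
    γ * (M + 1ℚ)    ≡⟨ *-assoc η (1/ (M + 1ℚ)) (M + 1ℚ) ⟩
    η * (1/ (M + 1ℚ) * (M + 1ℚ)) ≡⟨ cong (η *_) (*-inverseˡ (M + 1ℚ)) ⟩
    η * 1ℚ          ≡⟨ *-identityʳ η ⟩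
    η               ∎
    where open ≤-Reasoning

maximum : ∀ {n} → (Fin n → ℕ) → ℕ
maximum {zero} f  = 0
maximum {suc n} f = f Fin.zero ℕ.⊔ maximum (f ∘ Fin.suc)

≤-maximum : ∀ {n} (f : Fin n → ℕ) a → f a ℕ.≤ maximum f
≤-maximum f Fin.zero    = ℕP.m≤m⊔n _ _
≤-maximum f (Fin.suc a) = ℕP.≤-trans (≤-maximum (f ∘ Fin.suc) a) (ℕP.m≤n⊔m _ _)

maximum-≤ : ∀ {n} (f : Fin n → ℕ) {c} → (∀ a → f a ℕ.≤ c) → maximum f ℕ.≤ c
maximum-≤ {zero} f f≤c  = ℕ.z≤n
maximum-≤ {suc n} f f≤c = ℕP.⊔-lub (f≤c Fin.zero) (maximum-≤ (f ∘ Fin.suc) (f≤c ∘ Fin.suc))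

maximum-attained : ∀ {n} (f : Fin n → ℕ) → maximum f ≡ 0 ⊎ ∃[ a ] maximum f ≡ f a
maximum-attained {zero} f = inj₁ refl
maximum-attained {suc n} f with ℕP.⊔-sel (f Fin.zero) (maximum (f ∘ Fin.suc))
... | inj₁ max≡f₀ = inj₂ (Fin.zero , max≡f₀)
... | inj₂ max≡rest with maximum-attained (f ∘ Fin.suc)
...   | inj₁ rest≡0       = inj₁ (trans max≡rest rest≡0)
...   | inj₂ (a , rest≡fa) = inj₂ (Fin.suc a , trans max≡rest rest≡fa)

-- Lifts of chamber points and toric moves

IsGeneric : ∀ {n} → Graph n → Point n → Set
IsGeneric {n} G x = ∀ (a b : Fin n) → G a b ≡ true → x a ≢ x b

-- A realizer of ω lifts a point of its toric chamber: every edge has length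
-- strictly between 0 and 1, so adding 1 at a source of orientOf G x (or
-- subtracting 1 at a sink) performs exactly the toric flip at that vertex.
ShortEdge : ℚ → ℚ → Set
ShortEdge p q = p ≢ q × q < p + 1ℚ × p < q + 1ℚ

IsNarrow : ∀ {n} → Graph n → Point n → Set
IsNarrow {n} G x = ∀ (a b : Fin n) → G a b ≡ true → ShortEdge (x a) (x b)

Realizer : ∀ {n} → Graph n → Orientation n → Set
Realizer {n} G ω = Σ (Point n) λ x → IsNarrow G x × PointwiseEq (orientOf G x) ω

OrderReversed : ℚ → ℚ → ℚ → ℚ → Set
OrderReversed p q p′ q′ = (p′ < q′ ⇔ q < p) × (q′ < p′ ⇔ p < q)

PreservesEdgeOrder : ∀ {n} → Graph n → Point n → Point n → Set
PreservesEdgeOrder {n} G x y = ∀ (a b : Fin n) → G a b ≡ true → x a < x b → y a < y b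

narrow⇒generic : ∀ {n} {G : Graph n} {x} → IsNarrow G x → IsGeneric G x
narrow⇒generic narrow a b e = proj₁ (narrow a b e)

InUnitInterval : ∀ {n} → Point n → Set
InUnitInterval {n} x = ∀ (a : Fin n) → 0ℚ ≤ x a × x a < 1ℚ

unit-interval-narrow : ∀ {n} (G : Graph n) {x} → InUnitInterval x → IsGeneric G x → IsNarrow G x
unit-interval-narrow G {x} x∈I₀₁ generic a b e = generic a b e , below b a , below a b
  where
  below : ∀ a b → x a < x b + 1ℚ
  below a b = <-≤-trans (proj₂ (x∈I₀₁ a))
                (subst (_≤ x b + 1ℚ) (+-identityˡ 1ℚ) (+-monoˡ-≤ 1ℚ (proj₁ (x∈I₀₁ b))))

shortEdge-sym : ∀ {p q} → ShortEdge p q → ShortEdge q p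
shortEdge-sym (p≢q , q<p+1 , p<q+1) = p≢q ∘ sym , p<q+1 , q<p+1

both-true : ∀ {A B : Set} → A → B → A ⇔ B
both-true a b = mk⇔ (λ _ → b) (λ _ → a)

both-false : ∀ {A B : Set} → ¬ A → ¬ B → A ⇔ B
both-false ¬a ¬b = mk⇔ (⊥-elim ∘ ¬a) (⊥-elim ∘ ¬b)

module _ {n} (G : Graph n) where

  orientOf-edge : ∀ {x : Point n} {a b} → G a b ≡ true → x a < x b → orientOf G x a b ≡ true
  orientOf-edge {x} {a} {b} e x<x rewrite e = dec-true (x a <? x b) x<x

  orientOf-≮ : ∀ {x : Point n} {a b} → ¬ x a < x b → orientOf G x a b ≡ false
  orientOf-≮ {x} {a} {b} x≮x rewrite dec-false (x a <? x b) x≮x = ∧-zeroʳ (G a b)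

  orientOf-non-edge : ∀ {x : Point n} {a b} → G a b ≡ false → orientOf G x a b ≡ false
  orientOf-non-edge {a = a} {b} e rewrite e = refl

  orientOf-true⇒ : ∀ {x : Point n} {a b} → orientOf G x a b ≡ true → G a b ≡ true × x a < x b
  orientOf-true⇒ {x} {a} {b} o = by-edge (G a b) refl
    where
    by-edge : ∀ g → G a b ≡ g → G a b ≡ true × x a < x b
    by-edge false e with () ← trans (sym o) (orientOf-non-edge {x = x} e)
    by-edge true  e with x a <? x b
    ... | yes x<x = e , x<x
    ... | no x≮x with () ← trans (sym o) (orientOf-≮ {x = x} x≮x)

  orientOf-cong : ∀ {x y : Point n} {a b c d} → G a b ≡ G c d →
                  (G a b ≡ true → (x a < x b ⇔ y c < y d)) → orientOf G x a b ≡ orientOf G y c d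
  orientOf-cong {x} {y} {a} {b} {c} {d} G≡G iff = by-edge (G a b) refl
    where
    by-edge : ∀ g → G a b ≡ g → orientOf G x a b ≡ orientOf G y c d
    by-edge false e = trans (orientOf-non-edge {x = x} e) (sym (orientOf-non-edge {x = y} (trans (sym G≡G) e)))
    by-edge true e with x a <? x b
    ... | yes x<x = trans (orientOf-edge {x = x} e x<x) (sym (orientOf-edge {x = y} (trans (sym G≡G) e) (to (iff e) x<x)))
    ... | no x≮x  = trans (orientOf-≮ {x = x} x≮x) (sym (orientOf-≮ {x = y} (x≮x ∘ from (iff e))))

  orientOf-increasing : ∀ {ω : Orientation n} {x : Point n} → IsOrientationOf G ω →
               (∀ a b → ω a b ≡ true → x a < x b) → PointwiseEq (orientOf G x) ω × IsGeneric G x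
  orientOf-increasing {ω} {x} (ω⊆G , one-way) ω⇒< = agree , generic
    where
    reverse : ∀ {a b} → G a b ≡ true → ω a b ≡ false → ω b a ≡ true
    reverse {a} {b} e ωab with ω b a in ωba
    ... | true  = refl
    ... | false = ⊥-elim (one-way a b e (trans ωab (sym ωba)))
    agree : PointwiseEq (orientOf G x) ω
    agree a b = by-edge (G a b) refl (ω a b) refl
      where
      by-edge : ∀ g → G a b ≡ g → ∀ o → ω a b ≡ o → orientOf G x a b ≡ ω a b
      by-edge false e true  ωab with () ← trans (sym (ω⊆G a b ωab)) e
      by-edge false e false ωab = trans (orientOf-non-edge {x = x} e) (sym ωab)
      by-edge true  e true  ωab = trans (orientOf-edge {x = x} e (ω⇒< a b ωab)) (sym ωab)
      by-edge true  e false ωab = trans (orientOf-≮ {x = x} (<-asym (ω⇒< b a (reverse e ωab)))) (sym ωab)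
    generic : IsGeneric G x
    generic a b e with ω a b in ωab
    ... | true  = <⇒≢ (ω⇒< a b ωab)
    ... | false = <⇒≢ (ω⇒< b a (reverse e ωab)) ∘ sym

pointwise-trans : ∀ {n} {ω₁ ω₂ ω₃ : Orientation n} →
                  PointwiseEq ω₁ ω₂ → PointwiseEq ω₂ ω₃ → PointwiseEq ω₁ ω₃
pointwise-trans p q a b = trans (p a b) (q a b)

pointwise-sym : ∀ {n} {ω₁ ω₂ : Orientation n} → PointwiseEq ω₁ ω₂ → PointwiseEq ω₂ ω₁
pointwise-sym p a b = sym (p a b)

flipAt-cong : ∀ {n} {ω ω′ : Orientation n} v → PointwiseEq ω ω′ → PointwiseEq (flipAt ω v) (flipAt ω′ v)
flipAt-cong v ω≗ω′ a b with does (a ≟ v) ∨ does (b ≟ v)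
... | true  = ω≗ω′ b a
... | false = ω≗ω′ a b

flipAt-involutive : ∀ {n} (ω : Orientation n) v → PointwiseEq (flipAt (flipAt ω v) v) ω
flipAt-involutive ω v a b with does (a ≟ v) | does (b ≟ v)
... | true  | true  = refl
... | true  | false = refl
... | false | true  = refl
... | false | false = refl

flipAt-into : ∀ {n} (ω : Orientation n) v a → flipAt ω v a v ≡ ω v a
flipAt-into ω v a with does (a ≟ v)
... | true  = refl
... | false rewrite dec-true (v ≟ v) refl = refl

shiftAt : ∀ {n} → Point n → Fin n → ℚ → Point n
shiftAt x v c a = if does (a ≟ v) then x a + c else x a

shiftAt-self : ∀ {n} (x : Point n) v c → shiftAt x v c v ≡ x v + c
shiftAt-self x v c rewrite dec-true (v ≟ v) refl = refl

shiftAt-other : ∀ {n} (x : Point n) {v} c {a} → a ≢ v → shiftAt x v c a ≡ x a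
shiftAt-other x {v} c {a} a≢v rewrite dec-false (a ≟ v) a≢v = refl

module _ {n} (G : Graph n) (simple : IsSimple G) where

  private
    G-sym : ∀ a b → G a b ≡ G b a
    G-sym = proj₁ simple
    G-loopless : ∀ a → G a a ≡ false
    G-loopless = proj₂ simple

  neighbour≢ : ∀ {v u} → G v u ≡ true → u ≢ v
  neighbour≢ {v} e refl with () ← trans (sym e) (G-loopless v)

  reflects-edge-order : ∀ {x y} → IsGeneric G x → PreservesEdgeOrder G x y →
                        ∀ a b → G a b ≡ true → y a < y b → x a < x b
  reflects-edge-order {x} generic preserves a b e y<y with <-cmp (x a) (x b)
  ... | tri< x<x _ _ = x<x
  ... | tri≈ _ x≡x _ = ⊥-elim (generic a b e x≡x)
  ... | tri> _ _ x>x = ⊥-elim (<-asym y<y (preserves b a (trans (G-sym b a) e) x>x))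

  orientOf-preserved : ∀ {x y} → IsGeneric G x → PreservesEdgeOrder G x y →
                       PointwiseEq (orientOf G x) (orientOf G y)
  orientOf-preserved generic preserves a b =
    orientOf-cong G refl (λ e → mk⇔ (preserves a b e) (reflects-edge-order generic preserves a b e))

  generic-preserved : ∀ {x y} → IsGeneric G x → PreservesEdgeOrder G x y → IsGeneric G y
  generic-preserved {x} generic preserves a b e y≡y with <-cmp (x a) (x b)
  ... | tri< x<x _ _ = <⇒≢ (preserves a b e x<x) y≡y
  ... | tri≈ _ x≡x _ = generic a b e x≡x
  ... | tri> _ _ x>x = <⇒≢ (preserves b a (trans (G-sym b a) e) x>x) (sym y≡y)

  orientOf-flipAt : ∀ {x y : Point n} {v} → (∀ a → a ≢ v → y a ≡ x a) →
                    (∀ u → G v u ≡ true → OrderReversed (x v) (x u) (y v) (y u)) →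
                    PointwiseEq (orientOf G y) (flipAt (orientOf G x) v)
  orientOf-flipAt {x} {y} {v} off-v at-v a b with a ≟ v | b ≟ v
  ... | yes refl | yes refl =
    trans (orientOf-non-edge G {x = y} (G-loopless v)) (sym (orientOf-non-edge G {x = x} (G-loopless v)))
  ... | yes refl | no _ = orientOf-cong G (G-sym v b) (proj₁ ∘ at-v b)
  ... | no _ | yes refl = orientOf-cong G (G-sym a v) (λ e → proj₂ (at-v a (trans (G-sym v a) e)))
  ... | no a≢v | no b≢v =
    orientOf-cong G refl (λ _ → mk⇔ (subst₂ _<_ ya≡xa yb≡xb) (subst₂ _<_ (sym ya≡xa) (sym yb≡xb)))
    where
    ya≡xa : y a ≡ x a
    ya≡xa = off-v a a≢v
    yb≡xb : y b ≡ x b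
    yb≡xb = off-v b b≢v

  narrow-update : ∀ {x y : Point n} {v} → IsNarrow G x → (∀ a → a ≢ v → y a ≡ x a) →
                  (∀ u → G v u ≡ true → ShortEdge (y v) (y u)) → IsNarrow G y
  narrow-update {x} {y} {v} narrow off-v at-v a b e with a ≟ v | b ≟ v
  ... | yes refl | yes refl with () ← trans (sym e) (G-loopless v)
  ... | yes refl | no _     = at-v b e
  ... | no _     | yes refl = shortEdge-sym (at-v a (trans (G-sym v a) e))
  ... | no a≢v   | no b≢v   = subst₂ ShortEdge (sym (off-v a a≢v)) (sym (off-v b b≢v)) (narrow a b e)

  shiftAt-neighbour : ∀ {x : Point n} {v c u} (P : ℚ → ℚ → Set) → G v u ≡ true →
                      P (x v + c) (x u) → P (shiftAt x v c v) (shiftAt x v c u)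
  shiftAt-neighbour {x} {v} {c} P e =
    subst₂ P (sym (shiftAt-self x v c)) (sym (shiftAt-other x c (neighbour≢ e)))

  module _ {x : Point n} {v : Fin n} (narrow : IsNarrow G x) where

    private
      below : ∀ {u} → G v u ≡ true → x u < x v + 1ℚ
      below e = proj₁ (proj₂ (narrow _ _ e))

      above : ∀ {u} → G v u ≡ true → x v < x u + 1ℚ
      above e = proj₂ (proj₂ (narrow _ _ e))

    source-raised : (∀ u → G v u ≡ true → x v < x u) →
                    IsNarrow G (shiftAt x v 1ℚ) × PointwiseEq (orientOf G (shiftAt x v 1ℚ)) (flipAt (orientOf G x) v)
    source-raised source =
      narrow-update narrow (λ _ → shiftAt-other x 1ℚ) short , orientOf-flipAt (λ _ → shiftAt-other x 1ℚ) swapped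
      where
      short : ∀ u → G v u ≡ true → ShortEdge (shiftAt x v 1ℚ v) (shiftAt x v 1ℚ u)
      short u e = shiftAt-neighbour ShortEdge e
        (<⇒≢ (below e) ∘ sym , <-trans (below e) (p<p+1 _) , +-monoˡ-< 1ℚ (source u e))
      swapped : ∀ u → G v u ≡ true → OrderReversed (x v) (x u) (shiftAt x v 1ℚ v) (shiftAt x v 1ℚ u)
      swapped u e = shiftAt-neighbour (OrderReversed (x v) (x u)) e
        (both-false (<-asym (below e)) (<-asym (source u e)) , both-true (below e) (source u e))

    sink-lowered : (∀ u → G v u ≡ true → x u < x v) →
                   IsNarrow G (shiftAt x v (- 1ℚ)) × PointwiseEq (orientOf G (shiftAt x v (- 1ℚ))) (flipAt (orientOf G x) v)
    sink-lowered sink =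
      narrow-update narrow (λ _ → shiftAt-other x (- 1ℚ)) short , orientOf-flipAt (λ _ → shiftAt-other x (- 1ℚ)) swapped
      where
      lowered-below : ∀ {u} → G v u ≡ true → x v - 1ℚ < x u
      lowered-below e = p<q+1⇒p-1<q (above e)
      p-1+1≡p : ∀ p → p - 1ℚ + 1ℚ ≡ p
      p-1+1≡p = solve 1 (λ p → p :- con 1ℚ :+ con 1ℚ := p) refl
      short : ∀ u → G v u ≡ true → ShortEdge (shiftAt x v (- 1ℚ) v) (shiftAt x v (- 1ℚ) u)
      short u e = shiftAt-neighbour ShortEdge e
        (<⇒≢ (lowered-below e) , subst (x u <_) (sym (p-1+1≡p (x v))) (sink u e) , <-trans (lowered-below e) (p<p+1 _))
      swapped : ∀ u → G v u ≡ true → OrderReversed (x v) (x u) (shiftAt x v (- 1ℚ) v) (shiftAt x v (- 1ℚ) u)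
      swapped u e = shiftAt-neighbour (OrderReversed (x v) (x u)) e
        (both-true (lowered-below e) (sink u e) , both-false (<-asym (lowered-below e)) (<-asym (sink u e)))

  realizer-step : ∀ {ω ω′} → ToricStep G ω ω′ → Realizer G ω → Realizer G ω′
  realizer-step (inj₁ ω≗ω′) (x , narrow , x≗ω) = x , narrow , pointwise-trans x≗ω ω≗ω′
  realizer-step (inj₂ (inj₁ (v , source , flip≗ω′))) (x , narrow , x≗ω) =
    shiftAt x v 1ℚ , proj₁ raised ,
    pointwise-trans (proj₂ raised) (pointwise-trans (flipAt-cong v x≗ω) flip≗ω′)
    where
    raised : IsNarrow G (shiftAt x v 1ℚ) × PointwiseEq (orientOf G (shiftAt x v 1ℚ)) (flipAt (orientOf G x) v)
    raised = source-raised narrow (λ u e → proj₂ (orientOf-true⇒ G (trans (x≗ω v u) (source u e))))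
  realizer-step {ω} {ω′} (inj₂ (inj₂ (v , source′ , flip′≗ω))) (x , narrow , x≗ω) =
    shiftAt x v (- 1ℚ) , proj₁ lowered ,
    pointwise-trans (proj₂ lowered)
      (pointwise-trans (flipAt-cong v (pointwise-trans x≗ω (pointwise-sym flip′≗ω))) (flipAt-involutive ω′ v))
    where
    sink : ∀ u → G v u ≡ true → x u < x v
    sink u e = proj₂ (orientOf-true⇒ G (begin
      orientOf G x u v  ≡⟨ x≗ω u v ⟩
      ω u v             ≡⟨ flip′≗ω u v ⟨
      flipAt ω′ v u v   ≡⟨ flipAt-into ω′ v u ⟩
      ω′ v u            ≡⟨ source′ u e ⟩
      true              ∎))
      where open ≡-Reasoning
    lowered : IsNarrow G (shiftAt x v (- 1ℚ)) × PointwiseEq (orientOf G (shiftAt x v (- 1ℚ))) (flipAt (orientOf G x) v)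
    lowered = sink-lowered narrow sink

  realizer-transport : ∀ {ω ω′} → ToricEquiv G ω ω′ → Realizer G ω → Realizer G ω′
  realizer-transport ε                r = r
  realizer-transport (step ◅ steps) r = realizer-transport steps (realizer-step step r)

-- Heights in an acyclic orientation

module _ {n} (ω : Orientation n) where

  -- height k a is the number of edges of a longest ω-walk with at most k edges
  -- ending at a; by acyclicity it stabilises at k = n.
  height : ℕ → Fin n → ℕ
  height zero    a = 0
  height (suc k) a = maximum (λ b → if ω b a then suc (height k b) else 0)

  height-≤ : ∀ k a → height k a ℕ.≤ k
  height-≤ zero    a = ℕ.z≤n
  height-≤ (suc k) a = maximum-≤ _ bound
    where
    bound : ∀ b → (if ω b a then suc (height k b) else 0) ℕ.≤ suc k
    bound b with ω b a
    ... | true  = ℕ.s≤s (height-≤ k b)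
    ... | false = ℕ.z≤n

  height-step : ∀ k {a b} → ω b a ≡ true → suc (height k b) ℕ.≤ height (suc k) a
  height-step k {a} {b} ωba =
    subst (ℕ._≤ height (suc k) a) (cong (λ c → if c then suc (height k b) else 0) ωba)
      (≤-maximum (λ b → if ω b a then suc (height k b) else 0) b)

  height-grows : ∀ k a → height k a ℕ.< height (suc k) a →
                 ∃[ b ] ω b a ≡ true × height (suc k) a ≡ suc (height k b)
  height-grows k a grows with maximum-attained (λ b → if ω b a then suc (height k b) else 0)
  ... | inj₁ max≡0 = ⊥-elim (ℕP.n≮0 (subst (height k a ℕ.<_) max≡0 grows))
  ... | inj₂ (b , max≡) with ω b a in ωba
  ...   | true  = b , ωba , max≡
  ...   | false = ⊥-elim (ℕP.n≮0 (subst (height k a ℕ.<_) max≡ grows))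

  Walk : ℕ → Fin n → Set
  Walk k a = Σ (ℕ → Fin n) λ f → f 0 ≡ a × (∀ i → i ℕ.< k → ω (f (suc i)) (f i) ≡ true)

  walk-prepend : ∀ {k a b} → ω b a ≡ true → Walk k b → Walk (suc k) a
  walk-prepend {k} {a} {b} ωba (f , f0≡b , steps) = g , refl , steps′
    where
    g : ℕ → Fin n
    g zero    = a
    g (suc i) = f i
    steps′ : ∀ i → i ℕ.< suc k → ω (g (suc i)) (g i) ≡ true
    steps′ zero    _              = subst (λ c → ω c a ≡ true) (sym f0≡b) ωba
    steps′ (suc i) (ℕ.s≤s i<k) = steps i i<k

  height-grows⇒walk : ∀ k a → height k a ℕ.< height (suc k) a → Walk (suc k) a
  height-grows⇒walk zero a grows with height-grows zero a grows
  ... | b , ωba , _ = walk-prepend ωba ((λ _ → b) , refl , λ _ ())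
  height-grows⇒walk (suc k) a grows with height-grows (suc k) a grows
  ... | b , ωba , height≡ = walk-prepend ωba (height-grows⇒walk k b b-grows)
    where
    b-grows : height k b ℕ.< height (suc k) b
    b-grows = ℕP.≤-pred (ℕP.≤-<-trans (height-step k ωba) (subst (height (suc k) a ℕ.<_) height≡ grows))

  module _ (acyclic : IsAcyclic ω) where

    no-long-walk : ∀ {a} → ¬ Walk (suc n) a
    no-long-walk (f , _ , steps) with FinP.pigeonhole (ℕP.n<1+n n) (f ∘ Fin.toℕ)
    ... | i , j , i<j , fi≡fj =
      acyclic (f (Fin.toℕ i)) (subst (λ c → DPath ω c (f (Fin.toℕ i))) (sym fi≡fj) (path (Fin.toℕ j) i<j (FinP.toℕ≤n j)))
      where
      path : ∀ {i} j → i ℕ.< j → j ℕ.≤ suc n → DPath ω (f j) (f i)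
      path (suc j) i<j j<suc with ℕP.m≤n⇒m<n∨m≡n (ℕP.≤-pred i<j)
      ... | inj₁ i<j′ = steps j j<suc ∷⁺ path j i<j′ (ℕP.<⇒≤ j<suc)
      ... | inj₂ refl = [ steps j j<suc ]

    rank-increasing : ∀ {a b} → ω a b ≡ true → height n a ℕ.< height n b
    rank-increasing {a} {b} ωab = ℕP.≤-trans (height-step n ωab) stable
      where
      stable : height (suc n) b ℕ.≤ height n b
      stable = ℕP.≮⇒≥ (λ grows → no-long-walk (height-grows⇒walk n b grows))

acyclic-realizer : ∀ {n} (G : Graph n) {ω} → IsAcyclicOrientation G ω → Realizer G ω
acyclic-realizer {n} G {ω} (orientation , acyclic) = x , unit-interval-narrow G x∈I₀₁ (proj₂ ranked) , proj₁ ranked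
  where
  D : ℚ
  D = integral (+ suc n)
  instance
    1/D-pos : Positive (1/ D)
    1/D-pos = 1/pos⇒pos D
  scaled-< : ∀ {i j} → i ℕ.< j → ℤtoℚ (+ i) * 1/ D < ℤtoℚ (+ j) * 1/ D
  scaled-< i<j = *-monoˡ-<-pos (1/ D) (ℤtoℚ-mono-< (ℤ.+<+ i<j))
  x : Point n
  x a = ℤtoℚ (+ height ω n a) * 1/ D
  x∈I₀₁ : InUnitInterval x
  x∈I₀₁ a =
    subst (_≤ x a) (*-zeroˡ (1/ D))
      (*-monoʳ-≤-nonNeg (1/ D) {{pos⇒nonNeg (1/ D)}} (ℤtoℚ-mono-≤ {+ 0} {+ height ω n a} (ℤ.+≤+ ℕ.z≤n))) ,
    subst (x a <_) (trans (cong (_* 1/ D) (ℤtoℚ≡integral (+ suc n))) (*-inverseʳ D))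
      (scaled-< (ℕ.s≤s (height-≤ ω n a)))
  ranked : PointwiseEq (orientOf G x) ω × IsGeneric G x
  ranked = orientOf-increasing G orientation (λ a b ωab → scaled-< (rank-increasing ω acyclic ωab))

-- Vertices of the order polytope

UpSet : ∀ {n} → Orientation n → Subset n → Set
UpSet {n} ω I = ∀ (a b : Fin n) → ω a b ≡ true → a ∈ I → b ∈ I

-- χ I is definitionally twoBlock I 1ℚ 0ℚ, so these two lemmas also evaluate χ.
twoBlock-∈ : ∀ {n} {I : Subset n} {s t a} → a ∈ I → twoBlock I s t a ≡ s
twoBlock-∈ {I = I} {a = a} a∈I rewrite dec-true (a ∈? I) a∈I = refl

twoBlock-∉ : ∀ {n} {I : Subset n} {s t a} → a ∉ I → twoBlock I s t a ≡ t
twoBlock-∉ {I = I} {a = a} a∉I rewrite dec-false (a ∈? I) a∉I = refl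

upSet-closed : ∀ {n} {ω : Orientation n} {I a b} → UpSet ω I → PLe ω a b → a ∈ I → b ∈ I
upSet-closed up ε            a∈I = a∈I
upSet-closed up (ωab ◅ path) a∈I = upSet-closed up path (up _ _ ωab a∈I)

χ-in-polytope⇒upSet : ∀ {n} {ω : Orientation n} {I} → InOrderPolytope ω (χ I) → UpSet ω I
χ-in-polytope⇒upSet {I = I} (_ , monotone) a b ωab a∈I with b ∈? I
... | yes b∈I = b∈I
... | no  b∉I = ⊥-elim (1≰0 (subst₂ _≤_ (twoBlock-∈ a∈I) (twoBlock-∉ b∉I) (monotone a b (ωab ◅ ε))))
  where
  1≰0 : ¬ 1ℚ ≤ 0ℚ
  1≰0 (*≤* (ℤ.+≤+ ()))

convex-combination-zero : ∀ {t p q} → 0ℚ < t → t < 1ℚ → 0ℚ ≤ p → 0ℚ ≤ q →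
                          t * p + (1ℚ - t) * q ≡ 0ℚ → p ≡ 0ℚ × q ≡ 0ℚ
convex-combination-zero {t} {p} {q} 0<t t<1 0≤p 0≤q sum≡0 =
  ≤-antisym (≮⇒≥ 0≮p) 0≤p , ≤-antisym (≮⇒≥ 0≮q) 0≤q
  where
  0<1-t : 0ℚ < 1ℚ - t
  0<1-t = subst (_< 1ℚ - t) (+-inverseʳ t) (+-monoˡ-< (- t) t<1)
  scaled-≤ : ∀ {c r} → 0ℚ < c → 0ℚ ≤ r → 0ℚ ≤ c * r
  scaled-≤ {c} 0<c 0≤r = subst (_≤ c * _) (*-zeroʳ c) (*-monoˡ-≤-nonNeg c {{nonNegative (<⇒≤ 0<c)}} 0≤r)
  scaled-< : ∀ {c r} → 0ℚ < c → 0ℚ < r → 0ℚ < c * r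
  scaled-< {c} 0<c 0<r = subst (_< c * _) (*-zeroʳ c) (*-monoʳ-<-pos c {{positive 0<c}} 0<r)
  0≮p : ¬ 0ℚ < p
  0≮p 0<p = <-irrefl (sym sum≡0) (+-mono-<-≤ (scaled-< 0<t 0<p) (scaled-≤ 0<1-t 0≤q))
  0≮q : ¬ 0ℚ < q
  0≮q 0<q = <-irrefl (sym sum≡0) (+-mono-≤-< (scaled-≤ 0<t 0≤p) (scaled-< 0<1-t 0<q))

convex-combination-one : ∀ {t p q} → 0ℚ < t → t < 1ℚ → p ≤ 1ℚ → q ≤ 1ℚ →
                         t * p + (1ℚ - t) * q ≡ 1ℚ → p ≡ 1ℚ × q ≡ 1ℚ
convex-combination-one {t} {p} {q} 0<t t<1 p≤1 q≤1 sum≡1 = recover (proj₁ gaps≡0) , recover (proj₂ gaps≡0)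
  where
  complement : ∀ t p q → t * (1ℚ - p) + (1ℚ - t) * (1ℚ - q) ≡ 1ℚ - (t * p + (1ℚ - t) * q)
  complement = solve 3 (λ t p q → t :* (con 1ℚ :- p) :+ (con 1ℚ :- t) :* (con 1ℚ :- q)
                                  := con 1ℚ :- (t :* p :+ (con 1ℚ :- t) :* q)) refl
  gaps≡0 : 1ℚ - p ≡ 0ℚ × 1ℚ - q ≡ 0ℚ
  gaps≡0 = convex-combination-zero 0<t t<1 (p≤q⇒0≤q-p p≤1) (p≤q⇒0≤q-p q≤1)
    (trans (complement t p q) (trans (cong (_-_ 1ℚ) sum≡1) (+-inverseʳ 1ℚ)))
  recover : ∀ {r} → 1ℚ - r ≡ 0ℚ → r ≡ 1ℚ
  recover {r} 1-r≡0 = trans (r≡1-[1-r] r) (trans (cong (_-_ 1ℚ) 1-r≡0) (+-identityʳ 1ℚ))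
    where
    r≡1-[1-r] : ∀ r → r ≡ 1ℚ - (1ℚ - r)
    r≡1-[1-r] = solve 1 (λ r → r := con 1ℚ :- (con 1ℚ :- r)) refl

upSet⇒vertex : ∀ {n} {ω : Orientation n} {I} → UpSet ω I → IsVertexOfOrderPolytope ω (χ I)
upSet⇒vertex {n} {ω} {I} up = (in-cube , monotone) , extreme
  where
  0≤1 : 0ℚ ≤ 1ℚ
  0≤1 = *≤* (ℤ.+≤+ ℕ.z≤n)
  in-cube : ∀ a → 0ℚ ≤ χ I a × χ I a ≤ 1ℚ
  in-cube a with a ∈? I
  ... | yes _ = 0≤1 , ≤-refl
  ... | no  _ = ≤-refl , 0≤1
  monotone : ∀ a b → PLe ω a b → χ I a ≤ χ I b
  monotone a b a≤b with a ∈? I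
  ... | yes a∈I = ≤-reflexive (sym (twoBlock-∈ (upSet-closed up a≤b a∈I)))
  ... | no  _   = proj₁ (in-cube b)
  extreme : ∀ (y z : Point n) t → InOrderPolytope ω y → InOrderPolytope ω z → 0ℚ < t → t < 1ℚ →
            (∀ a → χ I a ≡ t * y a + (1ℚ - t) * z a) → ∀ a → y a ≡ z a
  extreme y z t (y-cube , _) (z-cube , _) 0<t t<1 χ≡ a with a ∈? I | χ≡ a
  ... | yes _ | 1≡ = let y≡1 , z≡1 = convex-combination-one 0<t t<1 (proj₂ (y-cube a)) (proj₂ (z-cube a)) (sym 1≡)
                     in trans y≡1 (sym z≡1)
  ... | no  _ | 0≡ = let y≡0 , z≡0 = convex-combination-zero 0<t t<1 (proj₁ (y-cube a)) (proj₁ (z-cube a)) (sym 0≡)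
                     in trans y≡0 (sym z≡0)

-- Lifts of one torus point have toric-equivalent orientations

decrementAt : ∀ {n} → (Fin n → ℕ) → Fin n → Fin n → ℕ
decrementAt d a b = if does (b ≟ a) then ℕ.pred (d b) else d b

decrementAt-self : ∀ {n} (d : Fin n → ℕ) {a} → 0 ℕ.< d a → suc (decrementAt d a a) ≡ d a
decrementAt-self d {a} 0<da rewrite dec-true (a ≟ a) refl = ℕP.suc-pred (d a) {{ℕ.>-nonZero 0<da}}

decrementAt-other : ∀ {n} (d : Fin n → ℕ) {a b} → b ≢ a → decrementAt d a b ≡ d b
decrementAt-other d {a} {b} b≢a rewrite dec-false (b ≟ a) b≢a = refl

sum-decrement : ∀ {n} (d d′ : Fin n → ℕ) a → suc (d′ a) ≡ d a → (∀ b → b ≢ a → d′ b ≡ d b) →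
                suc (sum d′) ≡ sum d
sum-decrement d d′ Fin.zero at-a elsewhere =
  cong₂ ℕ._+_ at-a (sum-cong-≗ (λ b → elsewhere (Fin.suc b) λ ()))
sum-decrement d d′ (Fin.suc a) at-a elsewhere = begin
  suc (d′ Fin.zero ℕ.+ sum (d′ ∘ Fin.suc))  ≡⟨ ℕP.+-suc (d′ Fin.zero) _ ⟨
  d′ Fin.zero ℕ.+ suc (sum (d′ ∘ Fin.suc))  ≡⟨ cong₂ ℕ._+_ (elsewhere Fin.zero λ ())
                                                  (sum-decrement (d ∘ Fin.suc) (d′ ∘ Fin.suc) a at-a
                                                     (λ b b≢a → elsewhere (Fin.suc b) (b≢a ∘ FinP.suc-injective))) ⟩
  d Fin.zero ℕ.+ sum (d ∘ Fin.suc)          ∎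
  where open ≡-Reasoning

sum-decrementAt : ∀ {n} (d : Fin n → ℕ) {a} → 0 ℕ.< d a → suc (sum (decrementAt d a)) ≡ sum d
sum-decrementAt d {a} 0<da = sum-decrement d (decrementAt d a) a (decrementAt-self d 0<da) (λ _ → decrementAt-other d)

raise-invariant : ∀ {n} {x v : Point n} (d : Fin n → ℕ) c → (∀ a → v a ≡ x a + ℤtoℚ (+ d a) + c) →
                  ∀ {a₁} → 0 ℕ.< d a₁ → ∀ b → v b ≡ shiftAt x a₁ 1ℚ b + ℤtoℚ (+ decrementAt d a₁ b) + c
raise-invariant {x = x} {v} d c v≡ {a₁} 0<d b with b ≟ a₁
... | no _     = v≡ b
... | yes refl = begin
  v b                                      ≡⟨ v≡ b ⟩
  x b + ℤtoℚ (+ d b) + c                   ≡⟨ cong (λ m → x b + ℤtoℚ (+ m) + c) (ℕP.suc-pred (d b) {{ℕ.>-nonZero 0<d}}) ⟨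
  x b + ℤtoℚ (+ 1 ℤ.+ + m) + c              ≡⟨ cong (λ q → x b + q + c) (ℤtoℚ-+ (+ 1) (+ m)) ⟩
  x b + (1ℚ + ℤtoℚ (+ m)) + c              ≡⟨ regroup (x b) (ℤtoℚ (+ m)) c ⟩
  x b + 1ℚ + ℤtoℚ (+ m) + c                ∎
  where
  open ≡-Reasoning
  m : ℕ
  m = ℕ.pred (d b)
  regroup : ∀ p q c → p + (1ℚ + q) + c ≡ p + 1ℚ + q + c
  regroup = solve 3 (λ p q c → p :+ (con 1ℚ :+ q) :+ c := p :+ con 1ℚ :+ q :+ c) refl

_≈ℤ_ : ∀ {n} → Point n → Point n → Set
_≈ℤ_ {n} x y = ∀ (a : Fin n) → ∃[ k ] y a ≡ x a + ℤtoℚ k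

EdgeSpread<1 : ∀ {n} → Graph n → Point n → Set
EdgeSpread<1 {n} G v = ∀ (a b : Fin n) → G a b ≡ true → v b < v a + 1ℚ

module _ {n} (G : Graph n) (simple : IsSimple G) where

  private
    G-sym : ∀ a b → G a b ≡ G b a
    G-sym = proj₁ simple

  -- A neighbour that must be raised too is higher by minimality; for any other
  -- neighbour u the spread bound v a₁ < v u + 1 forces it, as a₁ is raised by ≥ 1.
  lowest-raised-is-source : ∀ {x v : Point n} (d : Fin n → ℕ) c → IsGeneric G x → EdgeSpread<1 G v →
                            (∀ a → v a ≡ x a + ℤtoℚ (+ d a) + c) →
                            ∀ {a₁} → 0 ℕ.< d a₁ → (∀ b → 0 ℕ.< d b → x a₁ ≤ x b) →
                            ∀ u → G a₁ u ≡ true → x a₁ < x u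
  lowest-raised-is-source {x} {v} d c generic spread v≡ {a₁} 0<d lowest u e with 0 ℕ.<? d u | <-cmp (x a₁) (x u)
  ... | _        | tri< x<x _ _ = x<x
  ... | _        | tri≈ _ x≡x _ = ⊥-elim (generic a₁ u e x≡x)
  ... | yes 0<du | tri> _ _ x>x = ⊥-elim (<-irrefl refl (<-≤-trans x>x (lowest u 0<du)))
  ... | no  du≯0 | tri> _ _ _   = +-cancelʳ-< (1ℚ + c) (begin-strict
    x a₁ + (1ℚ + c)                 ≤⟨ +-monoʳ-≤ (x a₁) (+-monoˡ-≤ c (ℤtoℚ-mono-≤ {+ 1} {+ d a₁} (ℤ.+≤+ 0<d))) ⟩
    x a₁ + (ℤtoℚ (+ d a₁) + c)      ≡⟨ +-assoc (x a₁) _ c ⟨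
    x a₁ + ℤtoℚ (+ d a₁) + c        ≡⟨ v≡ a₁ ⟨
    v a₁                            <⟨ spread u a₁ (trans (G-sym u a₁) e) ⟩
    v u + 1ℚ                        ≡⟨ cong (_+ 1ℚ) (trans (v≡ u) (cong (λ m → x u + ℤtoℚ (+ m) + c) du≡0)) ⟩
    x u + 0ℚ + c + 1ℚ               ≡⟨ regroup (x u) c ⟩
    x u + (1ℚ + c)                  ∎)
    where
    open ≤-Reasoning
    du≡0 : d u ≡ 0
    du≡0 = ℕP.n≤0⇒n≡0 (ℕP.≮⇒≥ du≯0)
    regroup : ∀ p c → p + 0ℚ + c + 1ℚ ≡ p + (1ℚ + c)
    regroup = solve 2 (λ p c → p :+ con 0ℚ :+ c :+ con 1ℚ := p :+ (con 1ℚ :+ c)) refl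

  -- Raise, one unit at a time, the lowest vertex (in x) that still has to be raised.
  lift-by : ∀ N {x v : Point n} (d : Fin n → ℕ) c → sum d ≡ N → IsNarrow G x → EdgeSpread<1 G v →
            (∀ a → v a ≡ x a + ℤtoℚ (+ d a) + c) → ToricEquiv G (orientOf G x) (orientOf G v)
  lift-by N {x} {v} d c sum≡N narrow spread v≡ with argmin (λ a → 0 ℕ.<? d a) x | N
  ... | inj₁ none | _ = inj₁ (orientOf-preserved G simple (narrow⇒generic narrow) translated) ◅ ε
    where
    v≡x+c : ∀ a → v a ≡ x a + c
    v≡x+c a = trans (v≡ a) (trans (cong (λ m → x a + ℤtoℚ (+ m) + c) (ℕP.n≤0⇒n≡0 (ℕP.≮⇒≥ (none a))))
                                  (cong (_+ c) (+-identityʳ (x a))))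
    translated : PreservesEdgeOrder G x v
    translated a b _ x<x = subst₂ _<_ (sym (v≡x+c a)) (sym (v≡x+c b)) (+-monoˡ-< c x<x)
  ... | inj₂ (a₁ , 0<d , _) | zero = ⊥-elim (ℕP.1+n≢0 (trans (sum-decrementAt d 0<d) sum≡N))
  ... | inj₂ (a₁ , 0<d , lowest) | suc N′ =
    inj₂ (inj₁ (a₁ , (λ u e → orientOf-edge G e (source u e)) , pointwise-sym (proj₂ raised))) ◅
    lift-by N′ (decrementAt d a₁) c (ℕP.suc-injective (trans (sum-decrementAt d 0<d) sum≡N))
      (proj₁ raised) spread (raise-invariant d c v≡ 0<d)
    where
    source : ∀ u → G a₁ u ≡ true → x a₁ < x u
    source = lowest-raised-is-source d c (narrow⇒generic narrow) spread v≡ 0<d lowest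
    raised : IsNarrow G (shiftAt x a₁ 1ℚ) × PointwiseEq (orientOf G (shiftAt x a₁ 1ℚ)) (flipAt (orientOf G x) a₁)
    raised = source-raised G simple narrow source

  lift : ∀ {x v : Point n} → IsNarrow G x → x ≈ℤ v → EdgeSpread<1 G v → ToricEquiv G (orientOf G x) (orientOf G v)
  lift {x} {v} narrow x≈v spread with argmin {P = λ _ → ⊤} (λ _ → yes tt) (λ a → ℤtoℚ (proj₁ (x≈v a)))
  ... | inj₁ no-vertex = inj₁ (λ a → ⊥-elim (no-vertex a tt)) ◅ ε
  ... | inj₂ (a₀ , _ , lowest) = lift-by (sum d) d (ℤtoℚ (K a₀)) refl narrow spread v≡
    where
    K : Fin n → ℤ
    K a = proj₁ (x≈v a)
    d : Fin n → ℕ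
    d a = ℤ.∣ K a ℤ.- K a₀ ∣
    v≡ : ∀ a → v a ≡ x a + ℤtoℚ (+ d a) + ℤtoℚ (K a₀)
    v≡ a = begin
      v a                                            ≡⟨ proj₂ (x≈v a) ⟩
      x a + ℤtoℚ (K a)                               ≡⟨ regroup (x a) (ℤtoℚ (K a)) (ℤtoℚ (K a₀)) ⟩
      x a + (ℤtoℚ (K a) - ℤtoℚ (K a₀)) + ℤtoℚ (K a₀)  ≡⟨ cong (λ q → x a + q + ℤtoℚ (K a₀)) (ℤtoℚ-- (K a) (K a₀)) ⟨
      x a + ℤtoℚ (K a ℤ.- K a₀) + ℤtoℚ (K a₀)         ≡⟨ cong (λ k → x a + ℤtoℚ k + ℤtoℚ (K a₀)) d≡ ⟨
      x a + ℤtoℚ (+ d a) + ℤtoℚ (K a₀)                ∎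
      where
      open ≡-Reasoning
      d≡ : + d a ≡ K a ℤ.- K a₀
      d≡ = ℤP.0≤i⇒+∣i∣≡i (ℤP.i≤j⇒0≤j-i (ℤtoℚ-cancel-≤ {K a₀} {K a} (lowest a tt)))
      regroup : ∀ p q r → p + q ≡ p + (q - r) + r
      regroup = solve 3 (λ p q r → p :+ q := p :+ (q :- r) :+ r) refl

-- Toric filters

¼ ⅛ ¾ : ℚ
¼ = + 1 / 4
⅛ = + 1 / 8
¾ = + 3 / 4

level-bounds : ∀ {c s e} → ∣ s - c ∣ < ⅛ → ∣ e ∣ < ⅛ → c - ¼ < s + e × s + e < c + ¼
level-bounds {c} {s} {e} ∣s-c∣<⅛ ∣e∣<⅛ =
  subst₂ _<_ (lower c) (recentre s c e) (+-monoˡ-< c (+-mono-< (proj₁ s-c-bounds) (proj₁ e-bounds))) ,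
  subst₂ _<_ (recentre s c e) (upper c) (+-monoˡ-< c (+-mono-< (proj₂ s-c-bounds) (proj₂ e-bounds)))
  where
  lower : ∀ c → - ⅛ + - ⅛ + c ≡ c - ¼
  lower = solve 1 (λ c → :- con ⅛ :+ :- con ⅛ :+ c := c :- con ¼) refl
  upper : ∀ c → ⅛ + ⅛ + c ≡ c + ¼
  upper = solve 1 (λ c → con ⅛ :+ con ⅛ :+ c := c :+ con ¼) refl
  recentre : ∀ s c e → s - c + e + c ≡ s + e
  recentre = solve 3 (λ s c e → s :- c :+ e :+ c := s :+ e) refl
  s-c-bounds : - ⅛ < s - c × s - c < ⅛
  s-c-bounds = ∣p∣<r⇒-r<p<r ∣s-c∣<⅛
  e-bounds : - ⅛ < e × e < ⅛
  e-bounds = ∣p∣<r⇒-r<p<r ∣e∣<⅛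

small-positive : ∀ {r} → 0ℚ < r → ∃[ h ] 0ℚ < h × h < r × h ≤ ¼
small-positive {r} 0<r with r ≤? ½
... | yes r≤½ = r * ½ , 0<p⇒0<p*½ 0<r , r*½<r , *-monoʳ-≤-nonNeg ½ r≤½
  where
  r*½<r : r * ½ < r
  r*½<r = subst (r * ½ <_) (*-identityʳ r) (*-monoʳ-<-pos r {{positive 0<r}} (from-yes (½ <? 1ℚ)))
... | no  r≰½ = ¼ , from-yes (0ℚ <? ¼) , <-trans (from-yes (¼ <? ½)) (≰⇒> r≰½) , ≤-refl

fraction-shift : ∀ {F h} → 0ℚ ≤ F → F < 1ℚ → 0ℚ < h → h ≤ ¼ →
                 ∃[ σ ] ∣ σ ∣ ≡ h × h ≤ F + σ × F + σ + h ≤ 1ℚ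
fraction-shift {F} {h} 0≤F F<1 0<h h≤¼ = by-half (F ≤? ½)
  where
  F-h+h≡F : ∀ F h → F + - h + h ≡ F
  F-h+h≡F = solve 2 (λ F h → F :+ :- h :+ h := F) refl
  h+h-h≡h : ∀ h → h + h - h ≡ h
  h+h-h≡h = solve 1 (λ h → h :+ h :- h := h) refl
  by-half : Dec (F ≤ ½) → ∃[ σ ] ∣ σ ∣ ≡ h × h ≤ F + σ × F + σ + h ≤ 1ℚ
  by-half (yes F≤½) = h , 0≤p⇒∣p∣≡p (<⇒≤ 0<h) , subst (_≤ F + h) (+-identityˡ h) (+-monoˡ-≤ h 0≤F) ,
                      +-mono-≤ (+-mono-≤ F≤½ h≤¼) h≤¼
  by-half (no F≰½)  = - h , trans (∣-p∣≡∣p∣ h) (0≤p⇒∣p∣≡p (<⇒≤ 0<h)) ,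
                      subst (_≤ F + - h) (h+h-h≡h h)
                        (+-monoˡ-≤ (- h) (<⇒≤ (≤-<-trans (+-mono-≤ h≤¼ h≤¼) (≰⇒> F≰½)))) ,
                      ≤-trans (≤-reflexive (F-h+h≡F F h)) (<⇒≤ F<1)

window-from-gap : ∀ {s T g h} → T ≡ s - g → h ≤ g → g + h ≤ 1ℚ → T + h ≤ s × s + h ≤ T + 1ℚ
window-from-gap {s} {T} {g} {h} refl h≤g g+h≤1 =
  ≤-trans (+-monoʳ-≤ (s - g) h≤g) (≤-reflexive (s-g+g≡s s g)) ,
  subst (_≤ s - g + 1ℚ) (s-g+[g+h]≡s+h s g h) (+-monoʳ-≤ (s - g) g+h≤1)
  where
  s-g+g≡s : ∀ s g → s - g + g ≡ s
  s-g+g≡s = solve 2 (λ s g → s :- g :+ g := s) refl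
  s-g+[g+h]≡s+h : ∀ s g h → s - g + (g + h) ≡ s + h
  s-g+[g+h]≡s+h = solve 3 (λ s g h → s :- g :+ (g :+ h) := s :+ h) refl

two-level-window : ∀ {n} {I : Subset n} {S T δ} {v : Point n} → 0ℚ ≤ δ →
                   T + (δ + δ) ≤ S → S + (δ + δ) ≤ T + 1ℚ → (∀ a → ∣ twoBlock I S T a - v a ∣ < δ) →
                   (∀ a b → a ∈ I → b ∉ I → v b < v a) × (∀ a b → v b < v a + 1ℚ)
two-level-window {I = I} {S} {T} {δ} {v} 0≤δ low high near = separated , spread
  where
  near-∈ : ∀ {a} → a ∈ I → S - δ < v a × v a < S + δ
  near-∈ {a} a∈I = ∣p-q∣<δ⇒p-δ<q<p+δ {S} {v a} (subst (λ p → ∣ p - v a ∣ < δ) (twoBlock-∈ {I = I} a∈I) (near a))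
  near-∉ : ∀ {a} → a ∉ I → T - δ < v a × v a < T + δ
  near-∉ {a} a∉I = ∣p-q∣<δ⇒p-δ<q<p+δ {T} {v a} (subst (λ p → ∣ p - v a ∣ < δ) (twoBlock-∉ {I = I} a∉I) (near a))
  widen : ∀ p → p - δ ≤ p + δ
  widen p = +-monoʳ-≤ p (≤-trans (neg-antimono-≤ 0≤δ) 0≤δ)
  T+δ≤S-δ : T + δ ≤ S - δ
  T+δ≤S-δ = subst (_≤ S - δ) (shrink T δ) (+-monoˡ-≤ (- δ) low)
    where
    shrink : ∀ T δ → T + (δ + δ) - δ ≡ T + δ
    shrink = solve 2 (λ T δ → T :+ (δ :+ δ) :- δ := T :+ δ) refl
  S+δ≤T-δ+1 : S + δ ≤ T - δ + 1ℚ
  S+δ≤T-δ+1 = subst₂ _≤_ (shrink S δ) (shift T δ) (+-monoˡ-≤ (- δ) high)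
    where
    shrink : ∀ S δ → S + (δ + δ) - δ ≡ S + δ
    shrink = solve 2 (λ S δ → S :+ (δ :+ δ) :- δ := S :+ δ) refl
    shift : ∀ T δ → T + 1ℚ - δ ≡ T - δ + 1ℚ
    shift = solve 2 (λ T δ → T :+ con 1ℚ :- δ := T :- δ :+ con 1ℚ) refl
  separated : ∀ a b → a ∈ I → b ∉ I → v b < v a
  separated a b a∈I b∉I = <-trans (proj₂ (near-∉ b∉I)) (≤-<-trans T+δ≤S-δ (proj₁ (near-∈ a∈I)))
  in-range : ∀ a → T - δ < v a × v a < S + δ
  in-range a = by-block (a ∈? I)
    where
    by-block : Dec (a ∈ I) → T - δ < v a × v a < S + δ
    by-block (yes a∈I) = ≤-<-trans (≤-trans (widen T) T+δ≤S-δ) (proj₁ (near-∈ a∈I)) , proj₂ (near-∈ a∈I)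
    by-block (no  a∉I) = proj₁ (near-∉ a∉I) , <-≤-trans (proj₂ (near-∉ a∉I)) (≤-trans T+δ≤S-δ (widen S))
  spread : ∀ a b → v b < v a + 1ℚ
  spread a b = <-trans (<-≤-trans (proj₂ (in-range b)) S+δ≤T-δ+1) (+-monoˡ-< 1ℚ (proj₁ (in-range a)))

separated⇒upSet : ∀ {n} (G : Graph n) {I : Subset n} {v : Point n} →
                  (∀ a b → a ∈ I → b ∉ I → v b < v a) → UpSet (orientOf G v) I
separated⇒upSet G {I} separated a b o a∈I with b ∈? I
... | yes b∈I = b∈I
... | no  b∉I = ⊥-elim (<-asym (proj₂ (orientOf-true⇒ G o)) (separated a b a∈I b∉I))

module _ {n} (G : Graph n) {ω : Orientation n} where

  ≈ℤ-near : ∀ {p p′ z δ} {k j} → p′ ≡ p + ℤtoℚ j →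
            ∣ p - z - ℤtoℚ k ∣ < δ → ∣ p′ - z - ℤtoℚ (k ℤ.+ j) ∣ < δ
  ≈ℤ-near {p} {p′} {z} {δ} {k} {j} refl close = subst (λ q → ∣ q ∣ < δ) shifted close
    where
    shifted : p - z - ℤtoℚ k ≡ p + ℤtoℚ j - z - ℤtoℚ (k ℤ.+ j)
    shifted = trans (regroup p z (ℤtoℚ k) (ℤtoℚ j)) (cong (λ q → p + ℤtoℚ j - z - q) (sym (ℤtoℚ-+ k j)))
      where
      regroup : ∀ p z k j → p - z - k ≡ p + j - z - (k + j)
      regroup = solve 4 (λ p z k j → p :- z :- k := p :+ j :- z :- (k :+ j)) refl

  InClosure-shift : ∀ {y y′ : Point n} → InClosure G ω y → y ≈ℤ y′ → InClosure G ω y′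
  InClosure-shift {y} closure y≈y′ δ 0<δ =
    let z , chamber , near = closure δ 0<δ
    in z , chamber , λ a → proj₁ (near a) ℤ.+ proj₁ (y≈y′ a) ,
                           ≈ℤ-near {p = y a} {z = z a} {k = proj₁ (near a)} (proj₂ (y≈y′ a)) (proj₂ (near a))

  chamber-approx : ∀ {y z : Point n} {δ} → InChamber G ω z → (∀ a → ∃[ k ] ∣ y a - z a - ℤtoℚ k ∣ < δ) →
                   Σ (Point n) λ x → Σ (Point n) λ v →
                     IsNarrow G x × ToricEquiv G ω (orientOf G x) × x ≈ℤ v × (∀ a → ∣ y a - v a ∣ < δ)
  chamber-approx {y} {z} {δ} (x , x∈I₀₁ , z≈x , generic , ω~x) near =
    x , v , unit-interval-narrow G x∈I₀₁ generic , ω~x , x≈v , v-near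
    where
    k : Fin n → ℤ
    k a = proj₁ (near a)
    v : Point n
    v a = z a + ℤtoℚ (k a)
    x≈v : x ≈ℤ v
    x≈v a = k a ℤ.- j , (begin
      z a + ℤtoℚ (k a)                       ≡⟨ regroup (z a) (ℤtoℚ j) (ℤtoℚ (k a)) ⟩
      z a + ℤtoℚ j + (ℤtoℚ (k a) - ℤtoℚ j)    ≡⟨ cong₂ _+_ (sym (proj₂ (z≈x a))) (sym (ℤtoℚ-- (k a) j)) ⟩
      x a + ℤtoℚ (k a ℤ.- j)                 ∎)
      where
      open ≡-Reasoning
      j : ℤ
      j = proj₁ (z≈x a)
      regroup : ∀ z j k → z + k ≡ z + j + (k - j)
      regroup = solve 3 (λ z j k → z :+ k := z :+ j :+ (k :- j)) refl
    v-near : ∀ a → ∣ y a - v a ∣ < δ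
    v-near a = subst (λ q → ∣ q ∣ < δ) (regroup (y a) (z a) (ℤtoℚ (k a))) (proj₂ (near a))
      where
      regroup : ∀ y z k → y - z - k ≡ y - (z + k)
      regroup = solve 3 (λ y z k → y :- z :- k := y :- (z :+ k)) refl

module _ {n} (G : Graph n) (simple : IsSimple G) {ω : Orientation n} {I : Subset n} where

  twoBlock-shift : ∀ {s t} k → twoBlock I s t ≈ℤ twoBlock I s (t + ℤtoℚ k)
  twoBlock-shift {s} {t} k a = by-block (a ∈? I)
    where
    by-block : Dec (a ∈ I) → ∃[ j ] twoBlock I s (t + ℤtoℚ k) a ≡ twoBlock I s t a + ℤtoℚ j
    by-block (yes a∈I) = + 0 , trans (twoBlock-∈ a∈I) (sym (trans (cong (_+ 0ℚ) (twoBlock-∈ a∈I)) (+-identityʳ s)))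
    by-block (no  a∉I) = k , trans (twoBlock-∉ a∉I) (sym (cong (_+ ℤtoℚ k) (twoBlock-∉ a∉I)))

  upSet-from-window : ∀ {s T δ} → 0ℚ < δ → T + (δ + δ) ≤ s → s + (δ + δ) ≤ T + 1ℚ →
                      InClosure G ω (twoBlock I s T) → ∃[ ω′ ] ToricEquiv G ω ω′ × UpSet ω′ I
  upSet-from-window {s} {T} {δ} 0<δ low high closure =
    let z , chamber , near = closure δ 0<δ
        x , v , narrow , ω~x , x≈v , v-near = chamber-approx G {y = twoBlock I s T} {z = z} chamber near
        separated , spread = two-level-window (<⇒≤ 0<δ) low high v-near
    in orientOf G v , ω~x ◅◅ lift G simple narrow x≈v (λ a b _ → spread a b) , separated⇒upSet G separated

  -- Moving t₀ by ±h and shifting by ⌊s₀ - t₀⌋ puts the two levels of a point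
  -- of D_π in the square at a distance in [h, 1 - h].
  twoDim⇒upSet : ClosureMeetsDIsTwoDim G ω I → ∃[ ω′ ] ToricEquiv G ω ω′ × UpSet ω′ I
  twoDim⇒upSet (s₀ , t₀ , r , 0<r , square) =
    let h , 0<h , h<r , h≤¼ = small-positive 0<r
        M = floor (s₀ - t₀)
        ⌊⌋≤ , <⌊⌋+1 = floor-bounds (s₀ - t₀)
        F = s₀ - t₀ - ℤtoℚ M
        σ , ∣σ∣≡h , h≤gap , gap+h≤1 = fraction-shift {F} (p≤q⇒0≤q-p ⌊⌋≤) (q<p+1⇒q-p<1 <⌊⌋+1) 0<h h≤¼
        T+h≤s₀ , s₀+h≤T+1 = window-from-gap {s₀} {t₀ - σ + ℤtoℚ M} {F + σ} {h}
                              (level-identity s₀ t₀ σ (ℤtoℚ M)) h≤gap gap+h≤1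
    in upSet-from-window {s₀} {t₀ - σ + ℤtoℚ M} (0<p⇒0<p*½ 0<h)
         (subst (λ q → t₀ - σ + ℤtoℚ M + q ≤ s₀) (sym (halves h)) T+h≤s₀)
         (subst (λ q → s₀ + q ≤ t₀ - σ + ℤtoℚ M + 1ℚ) (sym (halves h)) s₀+h≤T+1)
         (InClosure-shift G {y = twoBlock I s₀ (t₀ - σ)} (square s₀ (t₀ - σ) centre-near (shift-near ∣σ∣≡h h<r))
           (twoBlock-shift {s₀} {t₀ - σ} M))
    where
    level-identity : ∀ s t σ m → t - σ + m ≡ s - (s - t - m + σ)
    level-identity = solve 4 (λ s t σ m → t :- σ :+ m := s :- (s :- t :- m :+ σ)) refl
    halves : ∀ h → h * ½ + h * ½ ≡ h
    halves = solve 1 (λ h → h :* con ½ :+ h :* con ½ := h) refl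
    centre-near : ∣ s₀ - s₀ ∣ < r
    centre-near = subst (λ q → ∣ q ∣ < r) (sym (+-inverseʳ s₀)) 0<r
    shift-near : ∀ {σ h} → ∣ σ ∣ ≡ h → h < r → ∣ t₀ - σ - t₀ ∣ < r
    shift-near {σ} ∣σ∣≡h h<r =
      subst (λ q → ∣ q ∣ < r) (sym (t-σ-t≡-σ t₀ σ)) (subst (_< r) (sym (trans (∣-p∣≡∣p∣ σ) ∣σ∣≡h)) h<r)
      where
      t-σ-t≡-σ : ∀ t σ → t - σ - t ≡ - σ
      t-σ-t≡-σ = solve 2 (λ t σ → t :- σ :- t := :- σ) refl

  module _ {ω′} (ω~ω′ : ToricEquiv G ω ω′) {x : Point n} (narrow : IsNarrow G x)
           (x≗ω′ : PointwiseEq (orientOf G x) ω′) (up : UpSet ω′ I) where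

    perturbed-in-chamber : ∀ {s t γ} → ∣ s - ¾ ∣ < ⅛ → ∣ t - ¼ ∣ < ⅛ → 0ℚ < γ → (∀ a → ∣ γ * x a ∣ < ⅛) →
                           InChamber G ω (λ a → twoBlock I s t a + γ * x a)
    perturbed-in-chamber {s} {t} {γ} s≈¾ t≈¼ 0<γ small =
      w , w∈I₀₁ , (λ a → + 0 , sym (+-identityʳ (w a))) , generic-preserved G simple generic preserves ,
      ω~ω′ ◅◅ (inj₁ (pointwise-trans (pointwise-sym x≗ω′) (orientOf-preserved G simple generic preserves)) ◅ ε)
      where
      generic : IsGeneric G x
      generic = narrow⇒generic narrow
      w : Point n
      w a = twoBlock I s t a + γ * x a
      high : ∀ {a} → a ∈ I → ¾ - ¼ < w a × w a < ¾ + ¼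
      high {a} a∈I = subst (λ p → ¾ - ¼ < p + γ * x a × p + γ * x a < ¾ + ¼)
                       (sym (twoBlock-∈ {I = I} {s} {t} a∈I)) (level-bounds {¾} {s} s≈¾ (small a))
      low : ∀ {a} → a ∉ I → ¼ - ¼ < w a × w a < ¼ + ¼
      low {a} a∉I = subst (λ p → ¼ - ¼ < p + γ * x a × p + γ * x a < ¼ + ¼)
                      (sym (twoBlock-∉ {I = I} {s} {t} a∉I)) (level-bounds {¼} {t} t≈¼ (small a))
      w∈I₀₁ : InUnitInterval w
      w∈I₀₁ a = by-block (a ∈? I)
        where
        by-block : Dec (a ∈ I) → 0ℚ ≤ w a × w a < 1ℚ
        by-block (yes a∈I) = <⇒≤ (<-trans (from-yes (0ℚ <? ¾ - ¼)) (proj₁ (high a∈I))) , proj₂ (high a∈I)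
        by-block (no  a∉I) = <⇒≤ (proj₁ (low a∉I)) , <-trans (proj₂ (low a∉I)) (from-yes (¼ + ¼ <? 1ℚ))
      same-level : ∀ {c a b} → twoBlock I s t a ≡ c → twoBlock I s t b ≡ c → x a < x b → w a < w b
      same-level {c} {a} {b} a≡c b≡c x<x =
        subst₂ _<_ (cong (_+ γ * x a) (sym a≡c)) (cong (_+ γ * x b) (sym b≡c))
          (+-monoʳ-< c (*-monoʳ-<-pos γ {{positive 0<γ}} x<x))
      preserves : PreservesEdgeOrder G x w
      preserves a b e x<x = by-blocks (a ∈? I) (b ∈? I)
        where
        by-blocks : Dec (a ∈ I) → Dec (b ∈ I) → w a < w b
        by-blocks (yes a∈I) (yes b∈I) = same-level (twoBlock-∈ a∈I) (twoBlock-∈ b∈I) x<x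
        by-blocks (no  a∉I) (no  b∉I) = same-level (twoBlock-∉ a∉I) (twoBlock-∉ b∉I) x<x
        by-blocks (yes a∈I) (no  b∉I) = ⊥-elim (b∉I (up a b (trans (sym (x≗ω′ a b)) (orientOf-edge G e x<x)) a∈I))
        by-blocks (no  a∉I) (yes b∈I) = <-trans (proj₂ (low a∉I)) (proj₁ (high b∈I))

    upSet⇒twoDim : ClosureMeetsDIsTwoDim G ω I
    upSet⇒twoDim = ¾ , ¼ , ⅛ , 0<⅛ , in-closure
      where
      0<⅛ : 0ℚ < ⅛
      0<⅛ = from-yes (0ℚ <? ⅛)
      perturbation-near : ∀ {p e δ} → ∣ e ∣ < δ → ∣ p - (p + e) - ℤtoℚ (+ 0) ∣ < δ
      perturbation-near {p} {e} {δ} ∣e∣<δ =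
        subst (_< δ) (sym (trans (cong ∣_∣ (p-[p+e]-0≡-e p e)) (∣-p∣≡∣p∣ e))) ∣e∣<δ
        where
        p-[p+e]-0≡-e : ∀ p e → p - (p + e) - 0ℚ ≡ - e
        p-[p+e]-0≡-e = solve 2 (λ p e → p :- (p :+ e) :- con 0ℚ := :- e) refl
      in-closure : ∀ s t → ∣ s - ¾ ∣ < ⅛ → ∣ t - ¼ ∣ < ⅛ → InClosure G ω (twoBlock I s t)
      in-closure s t s≈¾ t≈¼ δ 0<δ =
        let γ , 0<γ , γx-small = small-multiple x (0<⊓ 0<δ 0<⅛)
        in (λ a → twoBlock I s t a + γ * x a) ,
           perturbed-in-chamber s≈¾ t≈¼ 0<γ (λ a → <-≤-trans (γx-small a) (p⊓q≤q δ ⅛)) ,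
           λ a → + 0 , perturbation-near {twoBlock I s t a} (<-≤-trans (γx-small a) (p⊓q≤p δ ⅛))

subset-trichotomy : ∀ {n} (I : Subset n) → (∀ a → a ∉ I) ⊎ (∀ a → a ∈ I) ⊎ ((∃[ a ] a ∈ I) × (∃[ b ] b ∉ I))
subset-trichotomy I with FinP.any? (_∈? I) | FinP.any? (λ b → ¬? (b ∈? I))
... | no  none | _         = inj₁ λ a a∈I → none (a , a∈I)
... | yes _    | no  none′ = inj₂ (inj₁ λ b → decidable-stable (b ∈? I) λ b∉I → none′ (b , b∉I))
... | yes some | yes some′ = inj₂ (inj₂ (some , some′))

corollary7p5 : (n : ℕ) (G : Graph n) (ω : Orientation n) →
    IsSimple G → IsAcyclicOrientation G ω → (I : Subset n) →
    IsToricFilter G ω I ⇔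
      Σ (Orientation n) (λ ω' → ToricEquiv G ω ω' × IsVertexOfOrderPolytope ω' (χ I))
corollary7p5 n G ω simple acyclic I = mk⇔ filter⇒vertex vertex⇒filter
  where
  filter⇒vertex : IsToricFilter G ω I →
                  Σ (Orientation n) (λ ω′ → ToricEquiv G ω ω′ × IsVertexOfOrderPolytope ω′ (χ I))
  filter⇒vertex (inj₁ empty)                   = ω , ε , upSet⇒vertex (λ a _ _ a∈I → ⊥-elim (empty a a∈I))
  filter⇒vertex (inj₂ (inj₁ full))             = ω , ε , upSet⇒vertex (λ _ b _ _ → full b)
  filter⇒vertex (inj₂ (inj₂ (_ , _ , twoDim))) =
    let ω′ , ω~ω′ , up = twoDim⇒upSet G simple twoDim in ω′ , ω~ω′ , upSet⇒vertex up
  vertex⇒filter : Σ (Orientation n) (λ ω′ → ToricEquiv G ω ω′ × IsVertexOfOrderPolytope ω′ (χ I)) →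
                  IsToricFilter G ω I
  vertex⇒filter (ω′ , ω~ω′ , vertex) =
    let x , narrow , x≗ω′ = realizer-transport G simple ω~ω′ (acyclic-realizer G acyclic)
        twoDim = upSet⇒twoDim G simple ω~ω′ narrow x≗ω′ (χ-in-polytope⇒upSet (proj₁ vertex))
    in Sum.map₂ (Sum.map₂ (λ (a∈I , b∉I) → a∈I , b∉I , twoDim)) (subset-trichotomy I)
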